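{- A positive integer $m$ is a neo balcobalancing number if and only if $m^{2}-\frac{3m}{2}+1$ is a triangular number; more precisely, for every $n\ge1$, $$T_{B_{n}^{neobc}+R_{n}^{neobc}}=(B_{n}^{neobc})^{2}-\frac{3B_{n}^{neobc}}{2}+1,$$ where $T_k=\frac{k(k+1)}{2}$.
   Context: Triangular numbers: $T_k=\frac{k(k+1)}{2}$. A positive integer $m$ is a neo balcobalancing number if there is a positive integer $r$ (its neo balcobalancer) such that $(1+2+\cdots+(m-1))+(1+2+\cdots+m)=2[(m-1)+m+(m+1)+(m+2)+\cdots+(m+r)]$. $B_n^{neobc}$ denotes the $n$-th neo balcobalancing number in increasing order ($n\ge1$) and $R_n^{neobc}$ its neo balcobalancer. -}

module Defs where

open import Data.Nat using (ℕ; zero; suc; _+_; _*_; _∸_; _/_; _≤_; _<_)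
open import Data.List using (upTo; applyUpTo)
open import Data.Nat.ListAction using (sum)
open import Data.Empty using (⊥)
open import Data.Fin using (Fin; fromℕ) renaming (_<_ to _<ᶠ_)
open import Data.Product using (Σ; ∃; _×_)
open import Relation.Binary.PropositionalEquality using (_≡_)

-- Triangular numbers T_k = k(k+1)/2 (exact division, k(k+1) is even)
T : ℕ → ℕ
T k = (k * (k + 1)) / 2

sumTo : ℕ → ℕ
sumTo n = sum (upTo (suc n))

sumFrom : ℕ → ℕ → ℕ
sumFrom m r = sum (applyUpTo (m +_) (suc r))

IsNeoBalcobalancer : ℕ → ℕ → Set
IsNeoBalcobalancer m r =
  1 ≤ m × 1 ≤ r × (sumTo (m ∸ 1) + sumTo m ≡ 2 * ((m ∸ 1) + sumFrom m r))

IsNeoBalcobalancing : ℕ → Set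
IsNeoBalcobalancing m = ∃ λ r → IsNeoBalcobalancer m r

-- b is the n-th neo balcobalancing number (n ≥ 1) in increasing order:
-- there is a strictly increasing enumeration f of length n of
-- neo balcobalancing numbers which contains every neo balcobalancing
-- number ≤ b and whose last entry is b.
IsNthNeoBalcobalancing : ℕ → ℕ → Set
IsNthNeoBalcobalancing zero b = ⊥
IsNthNeoBalcobalancing (suc k) b =
  Σ (Fin (suc k) → ℕ) λ f →
    ((i j : Fin (suc k)) → i <ᶠ j → f i < f j)
    × ((i : Fin (suc k)) → IsNeoBalcobalancing (f i))
    × ((m : ℕ) → IsNeoBalcobalancing m → m ≤ b → ∃ λ i → f i ≡ m)
    × (f (fromℕ k) ≡ b)

-- Summing the two triangular numbers on the left gives (m-1)m/2 + m(m+1)/2 = m², and the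
-- balancer sum on the right is an arithmetic progression, so the balancing equation reads
-- m² = 2(m-1) + (r+1)(2m+r). Adding 2T_(m+r) + 3m to both sides and expanding shows it is
-- equivalent to 2T_(m+r) + 3m = 2m² + 2. Conversely, a solution k of 2T_k + 3m = 2m² + 2
-- must exceed m (for k < m the left side is too small, and k = m would make
-- m² - 4m + 2 vanish), so r = k - m is a positive balancer.
module Submission where

open import Defs
open import Data.Nat using (ℕ; zero; suc; _+_; _*_; _∸_; _/_; _≤_; _≰_; _<_; z≤n; s≤s; z<s)
open import Data.Nat.Properties
open import Data.Nat.DivMod using (m*n/n≡m)
open import Data.Nat.ListAction using (sum)
open import Data.Nat.ListAction.Properties using (sum-++)
open import Data.Nat.Tactic.RingSolver using (solve-∀)
open import Data.List using (applyUpTo; [_]; _++_)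
open import Data.List.Properties using (applyUpTo-∷ʳ)
open import Data.Product using (∃; _×_; _,_)
open import Data.Sum using (inj₁; inj₂)
open import Function.Bundles using (_⇔_; mk⇔; Equivalence)
open import Relation.Binary.PropositionalEquality
  using (_≡_; _≢_; refl; sym; trans; cong; cong₂; subst; module ≡-Reasoning)

double-sum-applyUpTo-+ : ∀ a n → 2 * sum (applyUpTo (a +_) (suc n)) ≡ suc n * (2 * a + n)
double-sum-applyUpTo-+ a zero = base a
  where
  base : ∀ a → 2 * (a + 0 + 0) ≡ 1 * (2 * a + 0)
  base = solve-∀
double-sum-applyUpTo-+ a (suc n) = begin
  2 * sum (applyUpTo (a +_) (suc (suc n)))
    ≡⟨ cong (λ xs → 2 * sum xs) (sym (applyUpTo-∷ʳ (a +_) (suc n))) ⟩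
  2 * sum (applyUpTo (a +_) (suc n) ++ [ a + suc n ])
    ≡⟨ cong (2 *_) (sum-++ (applyUpTo (a +_) (suc n)) [ a + suc n ]) ⟩
  2 * (sum (applyUpTo (a +_) (suc n)) + (a + suc n + 0))
    ≡⟨ *-distribˡ-+ 2 (sum (applyUpTo (a +_) (suc n))) _ ⟩
  2 * sum (applyUpTo (a +_) (suc n)) + 2 * (a + suc n + 0)
    ≡⟨ cong (_+ 2 * (a + suc n + 0)) (double-sum-applyUpTo-+ a n) ⟩
  suc n * (2 * a + n) + 2 * (a + suc n + 0)
    ≡⟨ step a n ⟩
  suc (suc n) * (2 * a + suc n) ∎
  where
  open ≡-Reasoning
  step : ∀ a n → suc n * (2 * a + n) + 2 * (a + suc n + 0) ≡ suc (suc n) * (2 * a + suc n)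
  step = solve-∀

double-sumTo : ∀ n → 2 * sumTo n ≡ suc n * n
double-sumTo = double-sum-applyUpTo-+ 0

double-T : ∀ k → 2 * T k ≡ k * (k + 1)
double-T k = begin
  2 * (k * (k + 1) / 2)        ≡⟨ cong (λ x → 2 * (x / 2)) pronic≡2*sumTo ⟩
  2 * (sumTo k * 2 / 2)        ≡⟨ cong (2 *_) (m*n/n≡m (sumTo k) 2) ⟩
  2 * sumTo k                  ≡⟨ *-comm 2 (sumTo k) ⟩
  sumTo k * 2                  ≡⟨ sym pronic≡2*sumTo ⟩
  k * (k + 1)                  ∎
  where
  open ≡-Reasoning
  pronic≡2*sumTo : k * (k + 1) ≡ sumTo k * 2
  pronic≡2*sumTo = trans (trans (*-comm k (k + 1)) (cong (_* k) (+-comm k 1)))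
                         (trans (sym (double-sumTo k)) (*-comm 2 (sumTo k)))

sumTo-pred+sumTo : ∀ m → sumTo (m ∸ 1) + sumTo m ≡ m * m
sumTo-pred+sumTo zero = refl
sumTo-pred+sumTo (suc p) = *-cancelˡ-≡ _ _ 2 (begin
  2 * (sumTo p + sumTo (suc p))              ≡⟨ *-distribˡ-+ 2 (sumTo p) (sumTo (suc p)) ⟩
  2 * sumTo p + 2 * sumTo (suc p)            ≡⟨ cong₂ _+_ (double-sumTo p) (double-sumTo (suc p)) ⟩
  suc p * p + suc (suc p) * suc p            ≡⟨ square p ⟩
  2 * (suc p * suc p)                        ∎)
  where
  open ≡-Reasoning
  square : ∀ p → suc p * p + suc (suc p) * suc p ≡ 2 * (suc p * suc p)
  square = solve-∀

balancing-identity : ∀ p r → let m = suc p in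
  2 * T (m + r) + 3 * m + (sumTo p + sumTo m) ≡ 2 * (m * m) + 2 + 2 * (p + sumFrom m r)
balancing-identity p r = begin
  2 * T (m + r) + 3 * m + (sumTo p + sumTo m)
    ≡⟨ cong₂ (λ t s → t + 3 * m + s) (double-T (m + r)) (sumTo-pred+sumTo m) ⟩
  (m + r) * (m + r + 1) + 3 * m + m * m
    ≡⟨ expand p r ⟩
  2 * (m * m) + 2 + (2 * p + suc r * (2 * m + r))
    ≡⟨ cong (λ s → 2 * (m * m) + 2 + (2 * p + s)) (sym (double-sum-applyUpTo-+ m r)) ⟩
  2 * (m * m) + 2 + (2 * p + 2 * sumFrom m r)
    ≡⟨ cong (2 * (m * m) + 2 +_) (sym (*-distribˡ-+ 2 p (sumFrom m r))) ⟩
  2 * (m * m) + 2 + 2 * (p + sumFrom m r) ∎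
  where
  open ≡-Reasoning
  m = suc p
  expand : ∀ p r → (suc p + r) * (suc p + r + 1) + 3 * suc p + suc p * suc p
                 ≡ 2 * (suc p * suc p) + 2 + (2 * p + suc r * (2 * suc p + r))
  expand = solve-∀

balancing⇔triangular : ∀ p r → let m = suc p in
  (sumTo p + sumTo m ≡ 2 * (p + sumFrom m r)) ⇔ (2 * T (m + r) + 3 * m ≡ 2 * (m * m) + 2)
balancing⇔triangular p r = mk⇔
  (λ balanced → +-cancelʳ-≡ (2 * B) _ _
    (trans (cong (2 * T (m + r) + 3 * m +_) (sym balanced)) (balancing-identity p r)))
  (λ triangular → +-cancelˡ-≡ (2 * (m * m) + 2) _ _
    (trans (cong (_+ (sumTo p + sumTo m)) (sym triangular)) (balancing-identity p r)))
  where
  m = suc p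
  B = p + sumFrom m r

too-small-below-diagonal : ∀ {k m} → k < m → k * (k + 1) + 3 * m < 2 * (m * m) + 2
too-small-below-diagonal {k} {suc p} (s≤s k≤p) = begin-strict
  k * (k + 1) + 3 * suc p                    ≤⟨ +-monoˡ-≤ (3 * suc p) (*-mono-≤ k≤p (+-monoˡ-≤ 1 k≤p)) ⟩
  p * (p + 1) + 3 * suc p                    <⟨ m<m+n _ z<s ⟩
  p * (p + 1) + 3 * suc p + suc (p * p)      ≡⟨ gap p ⟩
  2 * (suc p * suc p) + 2                    ∎
  where
  open ≤-Reasoning
  gap : ∀ p → p * (p + 1) + 3 * suc p + suc (p * p) ≡ 2 * (suc p * suc p) + 2
  gap = solve-∀

-- m² - 4m + 2 has no integer root.
no-solution-on-diagonal : ∀ m → m * (m + 1) + 3 * m ≢ 2 * (m * m) + 2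
no-solution-on-diagonal 0 = λ ()
no-solution-on-diagonal 1 = λ ()
no-solution-on-diagonal 2 = λ ()
no-solution-on-diagonal 3 = λ ()
no-solution-on-diagonal (suc (suc (suc (suc t)))) =
  <⇒≢ (subst (_<_ (m * (m + 1) + 3 * m)) (gap t) (m<m+n _ z<s))
  where
  m = 4 + t
  gap : ∀ t → (4 + t) * (4 + t + 1) + 3 * (4 + t) + suc (t * t + 4 * t + 1)
            ≡ 2 * ((4 + t) * (4 + t)) + 2
  gap = solve-∀

triangular-solution-exceeds : ∀ k {m} → 2 * T k + 3 * m ≡ 2 * (m * m) + 2 → m < k
triangular-solution-exceeds k {m} e = ≰⇒> k≰m
  where
  pronic : k * (k + 1) + 3 * m ≡ 2 * (m * m) + 2
  pronic = trans (cong (_+ 3 * m) (sym (double-T k))) e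
  k≰m : k ≰ m
  k≰m k≤m with m≤n⇒m<n∨m≡n k≤m
  ... | inj₁ k<m  = <⇒≢ (too-small-below-diagonal k<m) pronic
  ... | inj₂ refl = no-solution-on-diagonal m pronic

triangular⇒balancing : ∀ k {m} → 1 ≤ m → 2 * T k + 3 * m ≡ 2 * (m * m) + 2 → IsNeoBalcobalancing m
triangular⇒balancing k {suc p} _ triangular =
  k ∸ m , s≤s z≤n , m<n⇒0<n∸m m<k ,
  Equivalence.from (balancing⇔triangular p (k ∸ m)) (subst solves k≡m+r triangular)
  where
  m = suc p
  solves : ℕ → Set
  solves j = 2 * T j + 3 * m ≡ 2 * (m * m) + 2
  m<k : m < k
  m<k = triangular-solution-exceeds k triangular
  k≡m+r : k ≡ m + (k ∸ m)
  k≡m+r = sym (m+[n∸m]≡n (<⇒≤ m<k))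

balancer⇒triangular : ∀ {m r} → IsNeoBalcobalancer m r → 2 * T (m + r) + 3 * m ≡ 2 * (m * m) + 2
balancer⇒triangular {suc p} {r} (_ , _ , balanced) = Equivalence.to (balancing⇔triangular p r) balanced

theorem6p1 :
    ((m : ℕ) → 1 ≤ m →
       (IsNeoBalcobalancing m ⇔ (∃ λ k → 2 * T k + 3 * m ≡ 2 * (m * m) + 2)))
    × ((n b r : ℕ) → 1 ≤ n → IsNthNeoBalcobalancing n b → IsNeoBalcobalancer b r →
         2 * T (b + r) + 3 * b ≡ 2 * (b * b) + 2)
theorem6p1 =
  (λ m 1≤m → mk⇔ (λ { (r , balancer) → m + r , balancer⇒triangular balancer })
                 (λ { (k , triangular) → triangular⇒balancing k 1≤m triangular })) ,
  (λ _ _ _ _ _ balancer → balancer⇒triangular balancer)
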